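{- Let $G$ be a bipartite graph of minimum degree at least $2$. Let $u\in V(G)$ and $v\in N(u)$, and let $G'$ be obtained from $G$ by deleting every edge incident to $u$ except $uv$. Then the connected component of $G'$ containing $u$ is not a bicluster.
   Context: Let $G=(V_1\cup V_2,E)$ be bipartite with fixed bipartition; $N(x)$ denotes the neighborhood of $x$. A bicluster is a set $X\cup Y$ with $X\subseteq V_1$, $Y\subseteq V_2$ such that $N(x)=Y$ for all $x\in X$ and $N(y)=X$ for all $y\in Y$ (neighborhoods taken in the graph under consideration). -}

module Defs where

open import Data.Nat using (ℕ; _≥_)
open import Data.Bool using (Bool; true; false; _∧_; _∨_; not)
open import Data.Fin using (Fin)
import Data.Fin.Properties as FinP
open import Data.Fin.Subset using (Subset; ∣_∣)
open import Data.Vec using (tabulate)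
open import Data.Sum using (_⊎_; inj₁; inj₂)
import Data.Sum.Properties as SumP
open import Data.Product using (_×_)
open import Relation.Binary.PropositionalEquality using (_≡_)
open import Relation.Nullary using (does)
open import Function.Bundles using (_⇔_)

-- A (finite) bipartite graph with fixed bipartition V₁ = Fin n₁, V₂ = Fin n₂.
-- Edges only go between V₁ and V₂; adj x y = true iff xy is an edge.
record BipGraph (n₁ n₂ : ℕ) : Set where
  field
    adj : Fin n₁ → Fin n₂ → Bool
open BipGraph public

Vertex : ℕ → ℕ → Set
Vertex n₁ n₂ = Fin n₁ ⊎ Fin n₂

_≟V_ : ∀ {n₁ n₂} (p q : Vertex n₁ n₂) → Relation.Nullary.Dec (p ≡ q)
_≟V_ = SumP.≡-dec FinP._≟_ FinP._≟_

adjV : ∀ {n₁ n₂} → BipGraph n₁ n₂ → Vertex n₁ n₂ → Vertex n₁ n₂ → Bool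
adjV G (inj₁ x) (inj₂ y) = adj G x y
adjV G (inj₂ y) (inj₁ x) = adj G x y
adjV G (inj₁ _) (inj₁ _) = false
adjV G (inj₂ _) (inj₂ _) = false

Adj : ∀ {n₁ n₂} → BipGraph n₁ n₂ → Vertex n₁ n₂ → Vertex n₁ n₂ → Set
Adj G p q = adjV G p q ≡ true

N₁ : ∀ {n₁ n₂} → BipGraph n₁ n₂ → Fin n₁ → Subset n₂
N₁ G x = tabulate (λ y → adj G x y)

N₂ : ∀ {n₁ n₂} → BipGraph n₁ n₂ → Fin n₂ → Subset n₁
N₂ G y = tabulate (λ x → adj G x y)

degree : ∀ {n₁ n₂} → BipGraph n₁ n₂ → Vertex n₁ n₂ → ℕ
degree G (inj₁ x) = ∣ N₁ G x ∣
degree G (inj₂ y) = ∣ N₂ G y ∣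

MinDegreeAtLeast : ∀ {n₁ n₂} → ℕ → BipGraph n₁ n₂ → Set
MinDegreeAtLeast k G = ∀ p → degree G p ≥ k

-- G' : delete every edge incident to u except the edge uv.
-- An edge {p,q} is kept iff u ∉ {p,q}, or {p,q} = {u,v}.
keepEdge : ∀ {n₁ n₂} → (u v p q : Vertex n₁ n₂) → Bool
keepEdge u v p q =
  (not (does (p ≟V u)) ∧ not (does (q ≟V u)))
  ∨ (does (p ≟V u) ∧ does (q ≟V v))
  ∨ (does (q ≟V u) ∧ does (p ≟V v))

deleteAllBut : ∀ {n₁ n₂} → BipGraph n₁ n₂ → (u v : Vertex n₁ n₂) → BipGraph n₁ n₂
adj (deleteAllBut G u v) x y = adj G x y ∧ keepEdge u v (inj₁ x) (inj₂ y)

data Reach {n₁ n₂} (G : BipGraph n₁ n₂) (s : Vertex n₁ n₂) : Vertex n₁ n₂ → Set where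
  here : Reach G s s
  step : ∀ {p q} → Reach G s p → Adj G p q → Reach G s q

Component : ∀ {n₁ n₂} → BipGraph n₁ n₂ → Vertex n₁ n₂ → Vertex n₁ n₂ → Set
Component G s p = Reach G s p

-- S = X ∪ Y (X = S ∩ V₁, Y = S ∩ V₂) is a bicluster in G:
-- N(x) = Y for all x ∈ X and N(y) = X for all y ∈ Y (neighbourhoods in G).
IsBicluster : ∀ {n₁ n₂} → BipGraph n₁ n₂ → (Vertex n₁ n₂ → Set) → Set
IsBicluster {n₁} {n₂} G S =
  (∀ (x : Fin n₁) → S (inj₁ x) → ∀ (y : Fin n₂) → (Adj G (inj₁ x) (inj₂ y) ⇔ S (inj₂ y)))
  × (∀ (y : Fin n₂) → S (inj₂ y) → ∀ (x : Fin n₁) → (Adj G (inj₂ y) (inj₁ x) ⇔ S (inj₁ x)))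

-- In G' the vertex u has v as its only neighbour. By the degree bound v has a
-- second neighbour w ≠ u, and w a second neighbour z ≠ v; both edges vw and wz
-- survive in G', so w lies in the component of u. In a bicluster any two vertices
-- on the same side have the same neighbourhood, so z would be a neighbour of u in
-- G' different from v.
module Submission where

open import Defs
open import Data.Nat using (ℕ; _≤_; ≤-pred)
open import Data.Nat.Properties using (<⇒≤)
open import Data.Bool using (true; _∧_; _∨_; not)
open import Data.Bool.Properties using (∧-comm; ∨-comm)
open import Data.Empty using (⊥)
open import Data.Unit using (⊤)
open import Data.Fin using (Fin; zero; suc)
open import Data.Fin.Properties using (suc-injective)
open import Data.Fin.Subset using (Subset; ∣_∣; inside; outside)
open import Data.Vec using (_∷_; lookup)
open import Data.Vec.Properties using (lookup∘tabulate)
open import Data.Sum using (inj₁; inj₂)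
open import Data.Sum.Properties using (inj₂-injective; inj₁-injective)
open import Data.Product using (_,_; ∃-syntax; _×_)
open import Function using (_∘_)
open import Function.Bundles using (Equivalence)
open import Relation.Binary.PropositionalEquality
open import Relation.Nullary using (¬_; does; yes; no)
open import Relation.Nullary.Decidable using (dec-true; dec-false)

private
  variable
    n n₁ n₂ : ℕ

∣p∣≥1⇒∃inside : (p : Subset n) → 1 ≤ ∣ p ∣ → ∃[ b ] lookup p b ≡ inside
∣p∣≥1⇒∃inside (inside ∷ p) _ = zero , refl
∣p∣≥1⇒∃inside (outside ∷ p) 1≤∣p∣ with b , b∈p ← ∣p∣≥1⇒∃inside p 1≤∣p∣ = suc b , b∈p

∣p∣≥2⇒∃inside≢ : (p : Subset n) (a : Fin n) → 2 ≤ ∣ p ∣ →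
                 ∃[ b ] b ≢ a × lookup p b ≡ inside
∣p∣≥2⇒∃inside≢ (inside ∷ p) zero 2≤∣p∣
  with b , b∈p ← ∣p∣≥1⇒∃inside p (≤-pred 2≤∣p∣) = suc b , (λ ()) , b∈p
∣p∣≥2⇒∃inside≢ (outside ∷ p) zero 2≤∣p∣
  with b , b∈p ← ∣p∣≥1⇒∃inside p (<⇒≤ 2≤∣p∣) = suc b , (λ ()) , b∈p
∣p∣≥2⇒∃inside≢ (inside ∷ p) (suc a) _ = zero , (λ ()) , refl
∣p∣≥2⇒∃inside≢ (outside ∷ p) (suc a) 2≤∣p∣
  with b , b≢a , b∈p ← ∣p∣≥2⇒∃inside≢ p a 2≤∣p∣ = suc b , b≢a ∘ suc-injective , b∈p

SameSide : Vertex n₁ n₂ → Vertex n₁ n₂ → Set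
SameSide (inj₁ _) (inj₁ _) = ⊤
SameSide (inj₂ _) (inj₂ _) = ⊤
SameSide (inj₁ _) (inj₂ _) = ⊥
SameSide (inj₂ _) (inj₁ _) = ⊥

module _ (G : BipGraph n₁ n₂) where

  Adj-sym : ∀ p q → Adj G p q → Adj G q p
  Adj-sym (inj₁ _) (inj₂ _) p~q = p~q
  Adj-sym (inj₂ _) (inj₁ _) p~q = p~q

  Adj⇒≢ : ∀ p q → Adj G p q → p ≢ q
  Adj⇒≢ (inj₁ _) _ () refl
  Adj⇒≢ (inj₂ _) _ () refl

  SameSide⇒¬Adj : ∀ p q → SameSide p q → ¬ Adj G p q
  SameSide⇒¬Adj (inj₁ _) (inj₁ _) _ ()
  SameSide⇒¬Adj (inj₂ _) (inj₂ _) _ ()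

  common-neighbour⇒SameSide : ∀ p q r → Adj G p r → Adj G q r → SameSide p q
  common-neighbour⇒SameSide (inj₁ _) (inj₁ _) (inj₂ _) _ _ = _
  common-neighbour⇒SameSide (inj₂ _) (inj₂ _) (inj₁ _) _ _ = _

  another-neighbour : MinDegreeAtLeast 2 G → ∀ p q → Adj G p q → ∃[ r ] r ≢ q × Adj G p r
  another-neighbour δ≥2 (inj₁ x) (inj₂ y) _
    with b , b≢y , b∈N ← ∣p∣≥2⇒∃inside≢ (N₁ G x) y (δ≥2 (inj₁ x))
    = inj₂ b , b≢y ∘ inj₂-injective , trans (sym (lookup∘tabulate (adj G x) b)) b∈N
  another-neighbour δ≥2 (inj₂ y) (inj₁ x) _
    with a , a≢x , a∈N ← ∣p∣≥2⇒∃inside≢ (N₂ G y) x (δ≥2 (inj₂ y))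
    = inj₁ a , a≢x ∘ inj₁-injective , trans (sym (lookup∘tabulate (λ a → adj G a y) a)) a∈N

  bicluster-twins : ∀ S → IsBicluster G S → ∀ {p q} r → S p → S q → SameSide p q →
                    Adj G p r → Adj G q r
  bicluster-twins _ (X→ , Y→) {inj₁ x} {inj₁ x′} (inj₂ y) Sp Sq _ p~r =
    Equivalence.from (X→ x′ Sq y) (Equivalence.to (X→ x Sp y) p~r)
  bicluster-twins _ (X→ , Y→) {inj₂ y} {inj₂ y′} (inj₁ x) Sp Sq _ p~r =
    Equivalence.from (Y→ y′ Sq x) (Equivalence.to (Y→ y Sp x) p~r)

module _ (u v : Vertex n₁ n₂) where

  keepEdge-comm : ∀ p q → keepEdge u v p q ≡ keepEdge u v q p
  keepEdge-comm p q =
    cong₂ _∨_ (∧-comm (not (does (p ≟V u))) _) (∨-comm (does (p ≟V u) ∧ does (q ≟V v)) _)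

  keepEdge-uv : keepEdge u v u v ≡ true
  keepEdge-uv rewrite dec-true (u ≟V u) refl | dec-true (v ≟V v) refl = refl

  keepEdge-away : ∀ {p q} → p ≢ u → q ≢ u → keepEdge u v p q ≡ true
  keepEdge-away {p} {q} p≢u q≢u rewrite dec-false (p ≟V u) p≢u | dec-false (q ≟V u) q≢u = refl

  keepEdge-at-u : ∀ q → keepEdge u v u q ≡ true → q ≡ v
  keepEdge-at-u q kept rewrite dec-true (u ≟V u) refl
    with q ≟V v | q ≟V u | u ≟V v | kept
  ... | yes q≡v | _       | _       | _ = q≡v
  ... | no _    | yes q≡u | yes u≡v | _ = trans q≡u u≡v
  ... | no _    | no _    | _       | ()
  ... | no _    | yes _   | no _    | ()

x∧y≡true⇒y≡true : ∀ {x y} → x ∧ y ≡ true → y ≡ true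
x∧y≡true⇒y≡true {true} y≡true = y≡true

module _ (G : BipGraph n₁ n₂) (u v : Vertex n₁ n₂) where

  Adj-deleteAllBut⁺ : ∀ p q → Adj G p q → keepEdge u v p q ≡ true →
                      Adj (deleteAllBut G u v) p q
  Adj-deleteAllBut⁺ (inj₁ _) (inj₂ _) p~q kept = cong₂ _∧_ p~q kept
  Adj-deleteAllBut⁺ (inj₂ y) (inj₁ x) p~q kept =
    cong₂ _∧_ p~q (trans (keepEdge-comm u v (inj₁ x) (inj₂ y)) kept)

  Adj-deleteAllBut⁻ : ∀ p q → Adj (deleteAllBut G u v) p q → keepEdge u v p q ≡ true
  Adj-deleteAllBut⁻ (inj₁ _) (inj₂ _) p~q = x∧y≡true⇒y≡true p~q
  Adj-deleteAllBut⁻ (inj₂ y) (inj₁ x) p~q =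
    trans (keepEdge-comm u v (inj₂ y) (inj₁ x)) (x∧y≡true⇒y≡true p~q)

lemma8 : ∀ {n₁ n₂} (G : BipGraph n₁ n₂) → MinDegreeAtLeast 2 G →
         (u v : Vertex n₁ n₂) → Adj G u v →
         ¬ IsBicluster (deleteAllBut G u v) (Component (deleteAllBut G u v) u)
lemma8 {n₁} {n₂} G δ≥2 u v u~v bicluster
  with w , w≢u , v~w ← another-neighbour G δ≥2 v u (Adj-sym G u v u~v)
  with z , z≢v , w~z ← another-neighbour G δ≥2 w v (Adj-sym G v w v~w)
  = z≢v (keepEdge-at-u u v z (Adj-deleteAllBut⁻ G u v u z u~′z))
  where
    w∼u : SameSide w u
    w∼u = common-neighbour⇒SameSide G w u v (Adj-sym G v w v~w) u~v

    z≢u : z ≢ u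
    z≢u refl = SameSide⇒¬Adj G w u w∼u w~z

    G′ : BipGraph n₁ n₂
    G′ = deleteAllBut G u v

    u~′v : Adj G′ u v
    u~′v = Adj-deleteAllBut⁺ G u v u v u~v (keepEdge-uv u v)

    v~′w : Adj G′ v w
    v~′w = Adj-deleteAllBut⁺ G u v v w v~w (keepEdge-away u v (Adj⇒≢ G u v u~v ∘ sym) w≢u)

    w~′z : Adj G′ w z
    w~′z = Adj-deleteAllBut⁺ G u v w z w~z (keepEdge-away u v w≢u z≢u)

    w∈C : Component G′ u w
    w∈C = step {p = v} (step here u~′v) v~′w

    u~′z : Adj G′ u z
    u~′z = bicluster-twins G′ (Component G′ u) bicluster z w∈C here w∼u w~′z
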